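{- Let $D_B$ be the ordered graph on vertex set $\{1,2,3,4\}$ whose edges are all pairs except $\{3,4\}$ (an ordering of the diamond $K_4-e$). Then $r_<(D_B)\le 15$.
   Context: An ordered graph on $n$ vertices is a graph with vertex set $[n]=\{1,\dots,n\}$ equipped with the natural order. Given an ordered graph $H$ on $[n]$ and a red/blue coloring of the edges of the complete graph $K_N$ on vertex set $[N]$, a monochromatic ordered copy of $H$ is a strictly increasing map $\phi:[n]\to[N]$ such that all edges $\{\phi(i),\phi(j)\}$ with $\{i,j\}\in E(H)$ receive the same color. The ordered Ramsey number $r_<(H)$ is the least $N$ such that every red/blue coloring of the edges of the complete graph on $[N]$ contains a monochromatic ordered copy of $H$. -}

module Defs where

open import Data.Nat using (ℕ; _≤_)
open import Data.Fin using (Fin; zero; suc; _<_)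
open import Data.Bool using (Bool; true; false)
open import Data.Product using (Σ; _×_; ∃)
open import Relation.Binary.PropositionalEquality using (_≡_)

-- Edge relation given on ordered pairs; only pairs i < j are consulted,
-- so each unordered edge {i,j} (i<j) is represented by edge i j.
record OrderedGraph (n : ℕ) : Set where
  field
    edge : Fin n → Fin n → Bool
open OrderedGraph public

data Colour : Set where
  red blue : Colour

-- A red/blue colouring of the edges of K_N on [N]: the colour of {x,y}
-- with x < y is col x y (values at x ≥ y are irrelevant).
Colouring : ℕ → Set
Colouring N = Fin N → Fin N → Colour

StrictlyIncreasing : ∀ {n N} → (Fin n → Fin N) → Set
StrictlyIncreasing {n} φ = ∀ (i j : Fin n) → i < j → φ i < φ j

MonoCopy : ∀ {n N} → OrderedGraph n → Colouring N → Colour → (Fin n → Fin N) → Set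
MonoCopy {n} H col c φ =
  StrictlyIncreasing φ ×
  (∀ (i j : Fin n) → i < j → edge H i j ≡ true → col (φ i) (φ j) ≡ c)

HasMonoCopy : ∀ {n N} → OrderedGraph n → Colouring N → Set
HasMonoCopy {n} {N} H col = Σ Colour λ c → Σ (Fin n → Fin N) λ φ → MonoCopy H col c φ

Arrows : ∀ {n} → ℕ → OrderedGraph n → Set
Arrows N H = (col : Colouring N) → HasMonoCopy H col

-- r_<(H) ≤ M : the least N with Arrows N H exists and is ≤ M, i.e.
-- some N ≤ M satisfies Arrows N H.
OrdRamseyLE : ∀ {n} → OrderedGraph n → ℕ → Set
OrdRamseyLE H M = Σ ℕ λ N → N ≤ M × Arrows N H

-- D_B : vertices 1,2,3,4 (Fin indices 0,1,2,3); all pairs except {3,4}.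
D-B : OrderedGraph 4
D-B = record { edge = e }
  where
  e : Fin 4 → Fin 4 → Bool
  e (suc (suc zero)) (suc (suc (suc zero))) = false
  e (suc (suc (suc zero))) (suc (suc zero)) = false
  e _ _ = true

-- Vertex 1 has 11 later vertices, so six of them, v₁ < ⋯ < v₆, are joined to it
-- in a common colour c. If v₁ has two later c-neighbours among them, these, v₁ and
-- vertex 1 form a copy. Otherwise v₁ has four later neighbours among them in the
-- opposite colour c′; the first of them, y, sees two of the remaining three in one
-- colour, giving a copy on {1, y} in colour c or on {v₁, y} in colour c′.
-- The argument in fact shows r_<(D_B) ≤ 12.
module Submission where

open import Defs
open import Data.Nat using (ℕ; zero; suc; _+_; _≤_; z≤n; s≤s)
open import Data.Nat.Properties
  using (_≤?_; ≤-refl; ≤-trans; ≤-pred; ≰⇒>; +-monoˡ-≤; +-cancelˡ-≤; +-suc; m≤m+n)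
open import Data.Fin using (Fin; zero; suc; _<_)
open import Data.Fin.Properties using (<-trans)
open import Data.Bool using (true)
open import Data.Unit using (⊤; tt)
open import Data.Product using (Σ; _×_; _,_; proj₁; proj₂)
open import Data.Sum using (_⊎_; inj₁; inj₂)
open import Function using (_∘_)
open import Relation.Nullary using (yes; no)
open import Relation.Binary.PropositionalEquality using (_≡_; refl; cong; trans)
open import Relation.Binary.PropositionalEquality.Properties using (module ≡-Reasoning)

+-pigeonhole : ∀ {m n k p q} → m + n ≡ k → p + q ≤ suc k → p ≤ m ⊎ q ≤ n
+-pigeonhole {m} {n} {p = p} {q} refl h with p ≤? m
... | yes p≤m = inj₁ p≤m
... | no p≰m  = inj₂ (+-cancelˡ-≤ m q n (≤-pred (≤-trans (+-monoˡ-≤ q (≰⇒> p≰m)) h)))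

opposite : Colour → Colour
opposite red  = blue
opposite blue = red

colour-cases : (k c : Colour) → k ≡ c ⊎ k ≡ opposite c
colour-cases red  red  = inj₁ refl
colour-cases red  blue = inj₂ refl
colour-cases blue red  = inj₂ refl
colour-cases blue blue = inj₁ refl

data Chain {N : ℕ} (P : Fin N → Set) (b : Fin N) : Set where
  []   : Chain P b
  cons : (v : Fin N) → b < v → P v → Chain P v → Chain P b

shift : ∀ {N} {b : Fin N} → Chain {N} (λ _ → ⊤) b → Chain {suc N} (λ _ → ⊤) (suc b)
shift []               = []
shift (cons v b<v _ l) = cons (suc v) (s≤s b<v) tt (shift l)

above-zero : ∀ n → Chain {suc n} (λ _ → ⊤) zero
above-zero zero    = []
above-zero (suc n) = cons (suc zero) (s≤s z≤n) tt (shift (above-zero n))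

module _ {N : ℕ} where

  private variable
    P : Fin N → Set
    b b′ : Fin N

  length : Chain P b → ℕ
  length []             = 0
  length (cons _ _ _ l) = suc (length l)

  weaken : b′ < b → Chain P b → Chain P b′
  weaken b′<b []                = []
  weaken b′<b (cons v b<v pv l) = cons v (<-trans b′<b b<v) pv l

  length-weaken : (b′<b : b′ < b) (l : Chain P b) → length (weaken b′<b l) ≡ length l
  length-weaken b′<b []             = refl
  length-weaken b′<b (cons _ _ _ _) = refl

  AtLeast : ℕ → (Fin N → Set) → Fin N → Set
  AtLeast n P b = Σ (Chain P b) λ l → n ≤ length l

  partition : (f : Fin N → Colour) (c : Colour) (l : Chain P b) →
    Σ (Chain (λ v → P v × f v ≡ c) b) λ L →
    Σ (Chain (λ v → P v × f v ≡ opposite c) b) λ M →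
    length L + length M ≡ length l
  partition f c [] = [] , [] , refl
  partition f c (cons v b<v pv l) with partition f c l | colour-cases (f v) c
  ... | L , M , eq | inj₁ fv≡c =
    cons v b<v (pv , fv≡c) L , weaken b<v M ,
    cong suc (trans (cong (length L +_) (length-weaken b<v M)) eq)
  ... | L , M , eq | inj₂ fv≡c′ =
    weaken b<v L , cons v b<v (pv , fv≡c′) M ,
    (begin
      length (weaken b<v L) + suc (length M) ≡⟨ cong (_+ suc (length M)) (length-weaken b<v L) ⟩
      length L + suc (length M)             ≡⟨ +-suc (length L) (length M) ⟩
      suc (length L + length M)             ≡⟨ cong suc eq ⟩
      suc (length l)                        ∎)
    where open ≡-Reasoning

  pigeonhole : (f : Fin N → Colour) (c : Colour) (l : Chain P b) (p q : ℕ) →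
    p + q ≤ suc (length l) →
    AtLeast p (λ v → P v × f v ≡ c) b ⊎ AtLeast q (λ v → P v × f v ≡ opposite c) b
  pigeonhole f c l p q h with partition f c l
  ... | L , M , eq with +-pigeonhole eq h
  ...   | inj₁ p≤L = inj₁ (L , p≤L)
  ...   | inj₂ q≤M = inj₂ (M , q≤M)

  module _ (col : Colouring N) where

    D-B-copy : ∀ {k a b c d} → a < b → b < c → c < d →
      col a b ≡ k → col a c ≡ k → col a d ≡ k → col b c ≡ k → col b d ≡ k →
      HasMonoCopy D-B col
    D-B-copy {k} {a} {b} {c} {d} a<b b<c c<d ab ac ad bc bd = k , φ , increasing , coloured
      where
      φ : Fin 4 → Fin N
      φ zero                   = a
      φ (suc zero)             = b
      φ (suc (suc zero))       = c
      φ (suc (suc (suc zero))) = d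

      increasing : StrictlyIncreasing φ
      increasing zero             (suc zero)             _ = a<b
      increasing zero             (suc (suc zero))       _ = <-trans a<b b<c
      increasing zero             (suc (suc (suc zero))) _ = <-trans a<b (<-trans b<c c<d)
      increasing (suc zero)       (suc (suc zero))       _ = b<c
      increasing (suc zero)       (suc (suc (suc zero))) _ = <-trans b<c c<d
      increasing (suc (suc zero)) (suc (suc (suc zero))) _ = c<d
      increasing _                      zero                   ()
      increasing (suc _)                (suc zero)             (s≤s ())
      increasing (suc (suc _))          (suc (suc zero))       (s≤s (s≤s ()))
      increasing (suc (suc (suc _)))    (suc (suc (suc zero))) (s≤s (s≤s (s≤s ())))

      coloured : ∀ i j → i < j → edge D-B i j ≡ true → col (φ i) (φ j) ≡ k
      coloured zero             (suc zero)             _ _ = ab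
      coloured zero             (suc (suc zero))       _ _ = ac
      coloured zero             (suc (suc (suc zero))) _ _ = ad
      coloured (suc zero)       (suc (suc zero))       _ _ = bc
      coloured (suc zero)       (suc (suc (suc zero))) _ _ = bd
      coloured (suc (suc zero)) (suc (suc (suc zero))) _ ()
      coloured _                      zero                   ()
      coloured (suc _)                (suc zero)             (s≤s ())
      coloured (suc (suc _))          (suc (suc zero))       (s≤s (s≤s ()))
      coloured (suc (suc (suc _)))    (suc (suc (suc zero))) (s≤s (s≤s (s≤s ())))

    D-B-over-edge : ∀ {k u v} → u < v → col u v ≡ k → (l : Chain P v) →
      (∀ {w} → P w → col u w ≡ k) → (∀ {w} → P w → col v w ≡ k) →
      2 ≤ length l → HasMonoCopy D-B col
    D-B-over-edge u<v uv (cons z v<z pz (cons w z<w pw _)) toU toV _ =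
      D-B-copy u<v v<z z<w uv (toU pz) (toU pw) (toV pz) (toV pw)
    D-B-over-edge u<v uv (cons _ _ _ []) toU toV (s≤s ())

    D-B-from-mixed-fan : ∀ {c a x} → a < x → (l : Chain P x) →
      (∀ {v} → P v → col a v ≡ c) → (∀ {v} → P v → col x v ≡ opposite c) →
      4 ≤ length l → HasMonoCopy D-B col
    D-B-from-mixed-fan {c = c} a<x (cons y x<y py l) toA toX (s≤s 3≤l)
      with pigeonhole (col y) c l 2 2 (s≤s 3≤l)
    ... | inj₁ (L , 2≤L) = D-B-over-edge (<-trans a<x x<y) (toA py) L (toA ∘ proj₁) proj₂ 2≤L
    ... | inj₂ (M , 2≤M) = D-B-over-edge x<y (toX py) M (toX ∘ proj₁) proj₂ 2≤M

    D-B-from-fan : ∀ {c a} (l : Chain P a) → (∀ {v} → P v → col a v ≡ c) →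
      6 ≤ length l → HasMonoCopy D-B col
    D-B-from-fan {c = c} (cons x a<x px l) toA (s≤s 5≤l)
      with pigeonhole (col x) c l 2 4 (s≤s 5≤l)
    ... | inj₁ (L , 2≤L) = D-B-over-edge a<x (toA px) L (toA ∘ proj₁) proj₂ 2≤L
    ... | inj₂ (M , 4≤M) = D-B-from-mixed-fan a<x M (toA ∘ proj₁) proj₂ 4≤M

    D-B-from-vertex : ∀ {a} (l : Chain P a) → 11 ≤ length l → HasMonoCopy D-B col
    D-B-from-vertex {a = a} l 11≤l with pigeonhole (col a) red l 6 6 (s≤s 11≤l)
    ... | inj₁ (L , 6≤L) = D-B-from-fan L proj₂ 6≤L
    ... | inj₂ (M , 6≤M) = D-B-from-fan M proj₂ 6≤M

arrows-12 : Arrows 12 D-B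
arrows-12 col = D-B-from-vertex col (above-zero 11) ≤-refl

theorem3p2 : OrdRamseyLE D-B 15
theorem3p2 = 12 , m≤m+n 12 3 , arrows-12
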